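{- For all $X,Y,Z\in R=\{1,\omega,\omega^*,\zeta\}$, $(X\cdot_F Y)\cdot_F Z\cong X\cdot_F(Y\cdot_F Z)$.
   Context: $\omega,\omega^*,\zeta$ are the order types of $\mathbb N$, the negative integers and $\mathbb Z$; $1$ is the one-point order. For linear orders $L,M$, $LM$ is the lexicographic product on $L\times M$; for a linear order $L$, $x\sim_F y$ iff only finitely many points lie between $x$ and $y$, and $L/\!\sim_F$ is the ordered set of classes; $L\cdot_F M$ is the order type of $(LM)/\!\sim_F$. -}

module Defs where

open import Data.Nat as ℕ using (ℕ)
open import Data.Integer as ℤ using (ℤ)
open import Data.Unit using (⊤)
open import Data.Empty using (⊥)
open import Data.Product using (Σ; _×_; _,_)
open import Data.Sum using (_⊎_)
open import Data.List using (List)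
open import Data.List.Relation.Unary.Any using (Any)
open import Relation.Nullary using (¬_)
open import Relation.Binary.PropositionalEquality using (_≡_)

-- A linear order presented on a setoid: a carrier, an equality _≈_
-- (points are the ≈-classes) and a strict order _<_.
record LO : Set₁ where
  field
    Carrier : Set
    _≈_     : Carrier → Carrier → Set
    _<_     : Carrier → Carrier → Set

open LO public

𝟙 : LO
𝟙 = record { Carrier = ⊤ ; _≈_ = _≡_ ; _<_ = λ _ _ → ⊥ }

ω : LO
ω = record { Carrier = ℕ ; _≈_ = _≡_ ; _<_ = ℕ._<_ }

ω* : LO
ω* = record { Carrier = ℕ ; _≈_ = _≡_ ; _<_ = λ x y → y ℕ.< x }

ζ : LO
ζ = record { Carrier = ℤ ; _≈_ = _≡_ ; _<_ = ℤ._<_ }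

_⊗_ : LO → LO → LO
L ⊗ M = record
  { Carrier = Carrier L × Carrier M
  ; _≈_ = λ { (a , b) (a' , b') → _≈_ L a a' × _≈_ M b b' }
  ; _<_ = λ { (a , b) (a' , b') → _<_ L a a' ⊎ (_≈_ L a a' × _<_ M b b') }
  }

Between : (L : LO) → Carrier L → Carrier L → Carrier L → Set
Between L x y z = (_<_ L x z × _<_ L z y) ⊎ (_<_ L y z × _<_ L z x)

_∼F_ : {L : LO} → Carrier L → Carrier L → Set
_∼F_ {L} x y = Σ (List (Carrier L)) λ zs →
  ∀ z → Between L x y z → Any (λ w → _≈_ L z w) zs

-- The condensation L/~F : same carrier, classes of ~F as points,
-- [x] < [y] iff x < y and x ≁F y.
_/F : LO → LO
L /F = record
  { Carrier = Carrier L
  ; _≈_ = _∼F_ {L}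
  ; _<_ = λ x y → _<_ L x y × ¬ (_∼F_ {L} x y)
  }

_·F_ : LO → LO → LO
L ·F M = (L ⊗ M) /F

infixl 7 _·F_

record _≅_ (L M : LO) : Set where
  field
    to      : Carrier L → Carrier M
    from    : Carrier M → Carrier L
    to-cong   : ∀ {x y} → _≈_ L x y → _≈_ M (to x) (to y)
    from-cong : ∀ {x y} → _≈_ M x y → _≈_ L (from x) (from y)
    to-from : ∀ y → _≈_ M (to (from y)) y
    from-to : ∀ x → _≈_ L (from (to x)) x
    to-mono   : ∀ {x y} → _<_ L x y → _<_ M (to x) (to y)
    from-mono : ∀ {x y} → _<_ M x y → _<_ L (from x) (from y)

data R : Set where
  one omega omegaStar zeta : R

⟦_⟧ : R → LO
⟦ one ⟧ = 𝟙
⟦ omega ⟧ = ω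
⟦ omegaStar ⟧ = ω*
⟦ zeta ⟧ = ζ

module Submission where

-- Each X ∈ R is locally finite: any two of its points have finitely many
-- points between them. Hence in X ⊗ Y the points of one copy of Y are all
-- ∼F-equivalent, and when Y is infinite two distinct copies are separated
-- by infinitely many points; so X ·F Y collapses each copy of Y to a point
-- and is X again, while in X ⊗ 1 ≅ X all points are ∼F, so X ·F 1 ≅ 1.
-- Thus ·F restricted to R is the operation "X · 1 = 1, X · Y = X
-- otherwise", which is associative. Both sides of the theorem are then
-- condensed in two steps onto the same element of R, and ·F respects these
-- condensations.

open import Defs
open import Data.Nat as ℕ using (ℕ; suc)
import Data.Nat.Properties as ℕP
open import Data.Integer as ℤ using (ℤ; +_; -[1+_]; ∣_∣)
import Data.Integer.Properties as ℤP
open import Data.Unit using (tt)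
open import Data.Empty using (⊥-elim)
open import Data.Product as Prod using (Σ; _×_; _,_; proj₁; proj₂)
open import Data.Sum as Sum using (_⊎_; inj₁; inj₂)
open import Data.List as List using (List; _++_; upTo)
open import Data.List.Membership.Propositional using (_∈_)
open import Data.List.Membership.Propositional.Properties
  using (∈-map⁺; ∈-++⁺ˡ; ∈-++⁺ʳ; ∈-upTo⁺)
open import Data.List.Relation.Unary.Any as Any using (Any)
import Data.List.Relation.Unary.Any.Properties as AnyP
open import Data.Fin as Fin using (Fin)
import Data.Fin.Properties as FinP
open import Function.Base using (_∘′_)
open import Function.Definitions using (Injective)
open import Relation.Nullary using (¬_)
open import Relation.Binary.Definitions using (Trichotomous; tri<; tri≈; tri>)
open import Relation.Binary.Consequences using (tri⇒asym; tri⇒irr)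
import Relation.Binary.Construct.Flip.EqAndOrd as Flip
open import Relation.Binary.PropositionalEquality

-- LO does not ask _<_ to respect _≈_, so _≅_ cannot transport ∼F. A
-- presentation A ↠ T instead has a strict section, which suffices.
record _↠_ (A T : LO) : Set where
  field
    proj           : Carrier A → Carrier T
    section        : Carrier T → Carrier A
    proj-section   : ∀ t → proj (section t) ≡ t
    proj-cong      : ∀ {x y} → _≈_ A x y → _≈_ T (proj x) (proj y)
    proj-injective : ∀ {x y} → _≈_ T (proj x) (proj y) → _≈_ A x y
    proj-mono      : ∀ {x y} → _<_ A x y → _<_ T (proj x) (proj y)
    proj-reflects  : ∀ {x y} → _<_ T (proj x) (proj y) → _<_ A x y

infix 4 _↠_

↠-trans : {A B C : LO} → A ↠ B → B ↠ C → A ↠ C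
↠-trans π ρ = record
  { proj           = λ x → P.proj (Π.proj x)
  ; section        = λ c → Π.section (P.section c)
  ; proj-section   = λ c → trans (cong P.proj (Π.proj-section (P.section c)))
                                 (P.proj-section c)
  ; proj-cong      = λ e → P.proj-cong (Π.proj-cong e)
  ; proj-injective = λ e → Π.proj-injective (P.proj-injective e)
  ; proj-mono      = λ l → P.proj-mono (Π.proj-mono l)
  ; proj-reflects  = λ l → Π.proj-reflects (P.proj-reflects l)
  }
  where
    module Π = _↠_ π
    module P = _↠_ ρ

≅-of-common-presentation : {A B W : LO} → (∀ {w} → _≈_ W w w) →
                           A ↠ W → B ↠ W → A ≅ B
≅-of-common-presentation {W = W} ≈-refl π ρ = record
  { to        = λ x → P.section (Π.proj x)
  ; from      = λ y → Π.section (P.proj y)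
  ; to-cong   = λ e → P.proj-injective (P-sections (Π.proj-cong e))
  ; from-cong = λ e → Π.proj-injective (Π-sections (P.proj-cong e))
  ; to-from   = λ y → P.proj-injective (Π-sections≈ (P.proj y))
  ; from-to   = λ x → Π.proj-injective (P-sections≈ (Π.proj x))
  ; to-mono   = λ l → P.proj-reflects (subst₂ (_<_ W) (sym (P.proj-section _))
                                          (sym (P.proj-section _)) (Π.proj-mono l))
  ; from-mono = λ l → Π.proj-reflects (subst₂ (_<_ W) (sym (Π.proj-section _))
                                          (sym (Π.proj-section _)) (P.proj-mono l))
  }
  where
    module Π = _↠_ π
    module P = _↠_ ρ

    P-sections : ∀ {u v} → _≈_ W u v → _≈_ W (P.proj (P.section u)) (P.proj (P.section v))
    P-sections = subst₂ (_≈_ W) (sym (P.proj-section _)) (sym (P.proj-section _))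

    Π-sections : ∀ {u v} → _≈_ W u v → _≈_ W (Π.proj (Π.section u)) (Π.proj (Π.section v))
    Π-sections = subst₂ (_≈_ W) (sym (Π.proj-section _)) (sym (Π.proj-section _))

    Π-sections≈ : ∀ w → _≈_ W (P.proj (P.section (Π.proj (Π.section w)))) w
    Π-sections≈ w = subst (λ v → _≈_ W v w)
      (sym (trans (cong P.proj (cong P.section (Π.proj-section w))) (P.proj-section w)))
      ≈-refl

    P-sections≈ : ∀ w → _≈_ W (Π.proj (Π.section (P.proj (P.section w)))) w
    P-sections≈ w = subst (λ v → _≈_ W v w)
      (sym (trans (cong Π.proj (cong Π.section (P.proj-section w))) (Π.proj-section w)))
      ≈-refl

⊗-congˡ : {A T : LO} (Z : LO) → A ↠ T → A ⊗ Z ↠ T ⊗ Z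
⊗-congˡ Z π = record
  { proj           = Prod.map₁ proj
  ; section        = Prod.map₁ section
  ; proj-section   = λ { (t , c) → cong (_, c) (proj-section t) }
  ; proj-cong      = Prod.map₁ proj-cong
  ; proj-injective = Prod.map₁ proj-injective
  ; proj-mono      = Sum.map proj-mono (Prod.map₁ proj-cong)
  ; proj-reflects  = Sum.map proj-reflects (Prod.map₁ proj-injective)
  }
  where open _↠_ π

⊗-congʳ : {A T : LO} (Z : LO) → A ↠ T → Z ⊗ A ↠ Z ⊗ T
⊗-congʳ Z π = record
  { proj           = Prod.map₂ proj
  ; section        = Prod.map₂ section
  ; proj-section   = λ { (c , t) → cong (c ,_) (proj-section t) }
  ; proj-cong      = Prod.map₂ proj-cong
  ; proj-injective = Prod.map₂ proj-injective
  ; proj-mono      = Sum.map₂ (Prod.map₂ proj-mono)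
  ; proj-reflects  = Sum.map₂ (Prod.map₂ proj-reflects)
  }
  where open _↠_ π

module _ {A T : LO} (π : A ↠ T) where
  open _↠_ π

  Between-proj : ∀ {x y z} → Between A x y z → Between T (proj x) (proj y) (proj z)
  Between-proj = Sum.map (Prod.map proj-mono proj-mono) (Prod.map proj-mono proj-mono)

  Between-reflect : ∀ {x y z} → Between T (proj x) (proj y) (proj z) → Between A x y z
  Between-reflect =
    Sum.map (Prod.map proj-reflects proj-reflects) (Prod.map proj-reflects proj-reflects)

  ∼F-proj : ∀ {x y} → _∼F_ {A} x y → _∼F_ {T} (proj x) (proj y)
  ∼F-proj (zs , covered) = List.map proj zs , λ t btw →
    let btw′ = subst (Between T _ _) (sym (proj-section t)) btw
    in AnyP.map⁺ (Any.map (λ e → subst (λ u → _≈_ T u _) (proj-section t) (proj-cong e))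
                          (covered (section t) (Between-reflect btw′)))

  ∼F-reflect : ∀ {x y} → _∼F_ {T} (proj x) (proj y) → _∼F_ {A} x y
  ∼F-reflect (ts , covered) = List.map section ts , λ z btw →
    AnyP.map⁺ (Any.map (λ e → proj-injective (subst (_≈_ T (proj z)) (sym (proj-section _)) e))
                       (covered (proj z) (Between-proj btw)))

/F-cong : {A T : LO} → A ↠ T → A /F ↠ T /F
/F-cong π = record
  { proj           = proj
  ; section        = section
  ; proj-section   = proj-section
  ; proj-cong      = ∼F-proj π
  ; proj-injective = ∼F-reflect π
  ; proj-mono      = Prod.map proj-mono (λ x≁y px∼py → x≁y (∼F-reflect π px∼py))
  ; proj-reflects  = Prod.map proj-reflects (λ px≁py x∼y → px≁py (∼F-proj π x∼y))
  }
  where open _↠_ π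

∼F-sym : {L : LO} {x y : Carrier L} → _∼F_ {L} x y → _∼F_ {L} y x
∼F-sym (zs , covered) = zs , λ z btw → covered z (Sum.swap btw)

-- Pigeonhole: a cover of the interval by |zs| points cannot absorb |zs| + 1
-- pairwise distinct points of the sequence.
injective-between⇒≁F : (L : LO) {x y : Carrier L} (g : ℕ → Carrier L) →
                       (∀ n → Between L x y (g n)) →
                       (∀ {n m w} → _≈_ L (g n) w → _≈_ L (g m) w → n ≡ m) →
                       ¬ (_∼F_ {L} x y)
injective-between⇒≁F L g between injective (zs , covered) =
  let i , j , i<j , same-index = FinP.pigeonhole (ℕP.n<1+n (List.length zs))
                                                 (λ i → Any.index (cover i))
  in ℕP.<-irrefl (injective (subst (λ k → _≈_ L (g (Fin.toℕ i)) (List.lookup zs k))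
                                   same-index (AnyP.lookup-index (cover i)))
                            (AnyP.lookup-index (cover j)))
                 i<j
  where
    cover : (i : Fin (suc (List.length zs))) → Any (_≈_ L (g (Fin.toℕ i))) zs
    cover i = covered (g (Fin.toℕ i)) (between (Fin.toℕ i))

record LocallyFinite (W : LO) : Set where
  field
    ≈⇒≡         : ∀ {a b} → _≈_ W a b → a ≡ b
    ≈-refl      : ∀ {a} → _≈_ W a a
    compare     : Trichotomous _≡_ (_<_ W)
    interval    : Carrier W → Carrier W → List (Carrier W)
    ∈-interval  : ∀ {a b k} → Between W a b k → k ∈ interval a b
    point       : Carrier W

  <-asym : ∀ {a b} → _<_ W a b → ¬ _<_ W b a
  <-asym = tri⇒asym compare

  <-irrefl : ∀ {a} → ¬ _<_ W a a
  <-irrefl = tri⇒irr compare refl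

InfinitelyManyAbove InfinitelyManyBelow Infinite : LO → Set
InfinitelyManyAbove W =
  ∀ b → Σ (ℕ → Carrier W) λ u → (∀ n → _<_ W b (u n)) × Injective _≡_ _≡_ u
InfinitelyManyBelow W =
  ∀ b → Σ (ℕ → Carrier W) λ u → (∀ n → _<_ W (u n) b) × Injective _≡_ _≡_ u
Infinite W = InfinitelyManyAbove W ⊎ InfinitelyManyBelow W

module _ {S : LO} (finS : LocallyFinite S) where
  open LocallyFinite finS

  module _ {Z : LO} where

    squeeze : ∀ {a b b′ z} → _<_ (S ⊗ Z) (a , b) z → _<_ (S ⊗ Z) z (a , b′) →
              _≈_ S (proj₁ z) a × _<_ Z b (proj₂ z) × _<_ Z (proj₂ z) b′
    squeeze (inj₁ a<z) (inj₁ z<a) = ⊥-elim (<-asym a<z z<a)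
    squeeze (inj₁ a<z) (inj₂ (z≈a , _)) with ≈⇒≡ z≈a
    ... | refl = ⊥-elim (<-irrefl a<z)
    squeeze (inj₂ (a≈z , _)) (inj₁ z<a) with ≈⇒≡ a≈z
    ... | refl = ⊥-elim (<-irrefl z<a)
    squeeze (inj₂ (_ , b<z)) (inj₂ (z≈a , z<b′)) = z≈a , b<z , z<b′

    between-same-row : ∀ {a b b′ z} → Between (S ⊗ Z) (a , b) (a , b′) z →
                       _≈_ S (proj₁ z) a × Between Z b b′ (proj₂ z)
    between-same-row (inj₁ (l , r)) = Prod.map₂ inj₁ (squeeze l r)
    between-same-row (inj₂ (l , r)) = Prod.map₂ inj₂ (squeeze l r)

    module _ (finZ : LocallyFinite Z) where
      module Z = LocallyFinite finZ

      same-row-∼F : ∀ a b b′ → _∼F_ {S ⊗ Z} (a , b) (a , b′)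
      same-row-∼F a b b′ = List.map (a ,_) (Z.interval b b′) , λ z btw →
        let (z≈a , btwZ) = between-same-row btw
        in AnyP.map⁺ (Any.map (λ { refl → z≈a , Z.≈-refl }) (Z.∈-interval btwZ))

      distinct-rows-≁F : Infinite Z → ∀ {a a′ b b′} → _<_ S a a′ →
                         ¬ (_∼F_ {S ⊗ Z} (a , b) (a′ , b′))
      distinct-rows-≁F (inj₁ above) {a} {b = b} a<a′ with above b
      ... | u , b<u , u-injective =
        injective-between⇒≁F (S ⊗ Z) (λ n → a , u n)
          (λ n → inj₁ (inj₂ (≈-refl , b<u n) , inj₁ a<a′))
          (λ e₁ e₂ → u-injective (trans (Z.≈⇒≡ (proj₂ e₁)) (sym (Z.≈⇒≡ (proj₂ e₂)))))
      distinct-rows-≁F (inj₂ below) {a′ = a′} {b′ = b′} a<a′ with below b′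
      ... | u , u<b′ , u-injective =
        injective-between⇒≁F (S ⊗ Z) (λ n → a′ , u n)
          (λ n → inj₁ (inj₁ a<a′ , inj₂ (≈-refl , u<b′ n)))
          (λ e₁ e₂ → u-injective (trans (Z.≈⇒≡ (proj₂ e₁)) (sym (Z.≈⇒≡ (proj₂ e₂)))))

      condense-⊗-infinite : Infinite Z → (S ⊗ Z) /F ↠ S
      condense-⊗-infinite infZ = record
        { proj           = proj₁
        ; section        = _, Z.point
        ; proj-section   = λ _ → refl
        ; proj-cong      = ∼F⇒same-row
        ; proj-injective = same-row⇒∼F
        ; proj-mono      = λ { (inj₁ a<a′ , _) → a<a′
                             ; (inj₂ (a≈a′ , _) , x≁y) → ⊥-elim (x≁y (same-row⇒∼F a≈a′)) }
        ; proj-reflects  = λ a<a′ → inj₁ a<a′ , distinct-rows-≁F infZ a<a′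
        }
        where
          same-row⇒∼F : ∀ {x y} → _≈_ S (proj₁ x) (proj₁ y) → _∼F_ {S ⊗ Z} x y
          same-row⇒∼F {a , b} {_ , b′} a≈a′ with ≈⇒≡ a≈a′
          ... | refl = same-row-∼F a b b′

          ∼F⇒same-row : ∀ {x y} → _∼F_ {S ⊗ Z} x y → _≈_ S (proj₁ x) (proj₁ y)
          ∼F⇒same-row {a , _} {a′ , _} x∼y with compare a a′
          ... | tri< a<a′ _ _ = ⊥-elim (distinct-rows-≁F infZ a<a′ x∼y)
          ... | tri≈ _ a≡a′ _ = subst (_≈_ S a) a≡a′ ≈-refl
          ... | tri> _ _ a′<a = ⊥-elim (distinct-rows-≁F infZ a′<a (∼F-sym {S ⊗ Z} x∼y))

  condense-⊗-𝟙 : (S ⊗ 𝟙) /F ↠ 𝟙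
  condense-⊗-𝟙 = record
    { proj           = λ _ → tt
    ; section        = λ _ → point , tt
    ; proj-section   = λ _ → refl
    ; proj-cong      = λ _ → refl
    ; proj-injective = λ {x y} _ → all-∼F x y
    ; proj-mono      = λ {x y} (_ , x≁y) → ⊥-elim (x≁y (all-∼F x y))
    ; proj-reflects  = λ ()
    }
    where
      between-rows : ∀ {a a′ z} → Between (S ⊗ 𝟙) (a , tt) (a′ , tt) z →
                     Between S a a′ (proj₁ z)
      between-rows = Sum.map (Prod.map first first) (Prod.map first first)
        where
          first : ∀ {x y} → _<_ (S ⊗ 𝟙) x y → _<_ S (proj₁ x) (proj₁ y)
          first (inj₁ l) = l
          first (inj₂ (_ , ()))

      all-∼F : ∀ x y → _∼F_ {S ⊗ 𝟙} x y
      all-∼F (a , tt) (a′ , tt) = List.map (_, tt) (interval a a′) , λ z btw →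
        AnyP.map⁺ (Any.map (λ { refl → ≈-refl , refl }) (∈-interval (between-rows btw)))

locallyFinite-𝟙 : LocallyFinite 𝟙
locallyFinite-𝟙 = record
  { ≈⇒≡        = λ e → e
  ; ≈-refl     = refl
  ; compare    = λ _ _ → tri≈ (λ ()) refl (λ ())
  ; interval   = λ _ _ → List.[]
  ; ∈-interval = λ { (inj₁ (() , _)) ; (inj₂ (() , _)) }
  ; point      = tt
  }

<-+-either : ∀ {k m n} → k ℕ.< m ⊎ k ℕ.< n → k ℕ.< m ℕ.+ n
<-+-either {n = n} (inj₁ k<m) = ℕP.m≤n⇒m≤n+o n k<m
<-+-either {m = m} (inj₂ k<n) = ℕP.m≤n⇒m≤o+n m k<n

locallyFinite-ω : LocallyFinite ω
locallyFinite-ω = record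
  { ≈⇒≡        = λ e → e
  ; ≈-refl     = refl
  ; compare    = ℕP.<-cmp
  ; interval   = λ b b′ → upTo (b ℕ.+ b′)
  ; ∈-interval = λ btw → ∈-upTo⁺ (<-+-either (Sum.swap (Sum.map proj₂ proj₂ btw)))
  ; point      = 0
  }

locallyFinite-ω* : LocallyFinite ω*
locallyFinite-ω* = record
  { ≈⇒≡        = λ e → e
  ; ≈-refl     = refl
  ; compare    = Flip.compare ℕ._<_ ℕP.<-cmp
  ; interval   = λ b b′ → upTo (b ℕ.+ b′)
  ; ∈-interval = λ btw → ∈-upTo⁺ (<-+-either (Sum.map proj₁ proj₁ btw))
  ; point      = 0
  }

+n<c⇒n<∣c∣ : ∀ {n c} → + n ℤ.< c → n ℕ.< ∣ c ∣
+n<c⇒n<∣c∣ (ℤ.+<+ n<m) = n<m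

c<-[1+n]⇒n<∣c∣ : ∀ {n c} → c ℤ.< -[1+ n ] → n ℕ.< ∣ c ∣
c<-[1+n]⇒n<∣c∣ (ℤ.-<- n<m) = ℕP.m<n⇒m<1+n n<m

-- Between b and b′ lie only integers k with ∣ k ∣ ≤ ∣ b ∣ + ∣ b′ ∣.
intervalℤ : ℤ → ℤ → List ℤ
intervalℤ b b′ = List.map +_ (upTo N) ++ List.map -[1+_] (upTo N)
  where N = ∣ b ∣ ℕ.+ ∣ b′ ∣

∈-intervalℤ : ∀ {b b′ k} → Between ζ b b′ k → k ∈ intervalℤ b b′
∈-intervalℤ {k = + n} btw = ∈-++⁺ˡ (∈-map⁺ +_ (∈-upTo⁺ (<-+-either
  (Sum.swap (Sum.map (+n<c⇒n<∣c∣ ∘′ proj₂) (+n<c⇒n<∣c∣ ∘′ proj₂) btw)))))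
∈-intervalℤ {b} {b′} { -[1+ n ]} btw = ∈-++⁺ʳ (List.map +_ (upTo (∣ b ∣ ℕ.+ ∣ b′ ∣)))
  (∈-map⁺ -[1+_] (∈-upTo⁺ (<-+-either
    (Sum.map (c<-[1+n]⇒n<∣c∣ ∘′ proj₁) (c<-[1+n]⇒n<∣c∣ ∘′ proj₁) btw))))

locallyFinite-ζ : LocallyFinite ζ
locallyFinite-ζ = record
  { ≈⇒≡        = λ e → e
  ; ≈-refl     = refl
  ; compare    = ℤP.<-cmp
  ; interval   = intervalℤ
  ; ∈-interval = ∈-intervalℤ
  ; point      = + 0
  }

locallyFinite : ∀ X → LocallyFinite ⟦ X ⟧
locallyFinite one       = locallyFinite-𝟙
locallyFinite omega     = locallyFinite-ω
locallyFinite omegaStar = locallyFinite-ω*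
locallyFinite zeta      = locallyFinite-ζ

above : ℕ → ℕ → ℕ
above b n = suc (b ℕ.+ n)

<-above : ∀ b n → b ℕ.< above b n
<-above b n = ℕ.s≤s (ℕP.m≤m+n b n)

above-injective : ∀ b → Injective _≡_ _≡_ (above b)
above-injective b e = ℕP.+-cancelˡ-≡ b _ _ (ℕP.suc-injective e)

infinitelyManyAbove-ω : InfinitelyManyAbove ω
infinitelyManyAbove-ω b = above b , <-above b , above-injective b

infinitelyManyBelow-ω* : InfinitelyManyBelow ω*
infinitelyManyBelow-ω* = infinitelyManyAbove-ω

infinitelyManyAbove-ζ : InfinitelyManyAbove ζ
infinitelyManyAbove-ζ b =
  (λ n → + above ∣ b ∣ n) , <-+above b , λ e → above-injective ∣ b ∣ (ℤP.+-injective e)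
  where
    <-+above : ∀ b n → b ℤ.< + above ∣ b ∣ n
    <-+above (+ m)    n = ℤ.+<+ (<-above m n)
    <-+above -[1+ m ] n = ℤ.-<+

_·R_ : R → R → R
X ·R one = one
X ·R _   = X

·R-assoc : ∀ X Y Z → (X ·R Y) ·R Z ≡ X ·R (Y ·R Z)
·R-assoc X Y one       = refl
·R-assoc X Y omega     = refl
·R-assoc X Y omegaStar = refl
·R-assoc X Y zeta      = refl

·F-↠ : ∀ X Y → ⟦ X ⟧ ·F ⟦ Y ⟧ ↠ ⟦ X ·R Y ⟧
·F-↠ X one       = condense-⊗-𝟙 (locallyFinite X)
·F-↠ X omega     = condense-⊗-infinite (locallyFinite X) locallyFinite-ω
                     (inj₁ infinitelyManyAbove-ω)
·F-↠ X omegaStar = condense-⊗-infinite (locallyFinite X) locallyFinite-ω*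
                     (inj₂ infinitelyManyBelow-ω*)
·F-↠ X zeta      = condense-⊗-infinite (locallyFinite X) locallyFinite-ζ
                     (inj₁ infinitelyManyAbove-ζ)

mainTheorem14 : (X Y Z : R) →
    ((⟦ X ⟧ ·F ⟦ Y ⟧) ·F ⟦ Z ⟧) ≅ (⟦ X ⟧ ·F (⟦ Y ⟧ ·F ⟦ Z ⟧))
mainTheorem14 X Y Z =
  ≅-of-common-presentation (LocallyFinite.≈-refl (locallyFinite W)) left right
  where
    W = X ·R (Y ·R Z)

    left : (⟦ X ⟧ ·F ⟦ Y ⟧) ·F ⟦ Z ⟧ ↠ ⟦ W ⟧
    left = subst (λ V → (⟦ X ⟧ ·F ⟦ Y ⟧) ·F ⟦ Z ⟧ ↠ ⟦ V ⟧) (·R-assoc X Y Z)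
             (↠-trans (/F-cong (⊗-congˡ ⟦ Z ⟧ (·F-↠ X Y))) (·F-↠ (X ·R Y) Z))

    right : ⟦ X ⟧ ·F (⟦ Y ⟧ ·F ⟦ Z ⟧) ↠ ⟦ W ⟧
    right = ↠-trans (/F-cong (⊗-congʳ ⟦ X ⟧ (·F-↠ Y Z))) (·F-↠ X (Y ·R Z))
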